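{- (Canonicity) In the Fitch-style calculus for $IK$: let $\Gamma$ be a context containing no variable assignments (i.e. consisting only of locks), suppose $\Gamma\vdash t:A$ is derivable and $t$ is normal. Then the outermost term former of $t$ is the introduction form for the main type former of $A$.
   Context: Types: $A,B ::= p \mid 1 \mid A\times B \mid A\to B \mid 0 \mid A+B \mid \Box A$ ($p$ atoms; there are no term constants). Contexts: $\Gamma ::= \cdot \mid \Gamma,x:A \mid \Gamma,\bullet$ (variables distinct; $\bullet$ is a structural symbol called a lock). Terms: $x$, $\langle\rangle$, $\langle t,u\rangle$, $\pi_1 t$, $\pi_2 t$, $\lambda x.t$, $t\,u$, $\mathrm{inl}\,t$, $\mathrm{inr}\,t$, $\mathrm{case}\ s\ \mathrm{of}\ (x.t;\,y.u)$, $\mathrm{abort}\,t$, $\mathrm{shut}\,t$, $\mathrm{open}\,t$. Introduction forms: $\langle\rangle$ for $1$, $\langle t,u\rangle$ for $\times$, $\lambda x.t$ for $\to$, $\mathrm{inl}\,t$/$\mathrm{inr}\,t$ for $+$, $\mathrm{shut}\,t$ for $\Box$; atoms and $0$ have no introduction form. Typing rules: (var) $\Gamma,x:A,\Gamma'\vdash x:A$ provided $\Gamma'$ contains no lock; (products) $\Gamma\vdash\langle\rangle:1$; from $\Gamma\vdash t:A$, $\Gamma\vdash u:B$ infer $\Gamma\vdash\langle t,u\rangle:A\times B$; from $\Gamma\vdash t:A_1\times A_2$ infer $\Gamma\vdash\pi_i t:A_i$; (functions) from $\Gamma,x:A\vdash t:B$ infer $\Gamma\vdash\lambda x.t:A\to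 B$; from $\Gamma\vdash t:A\to B$, $\Gamma\vdash u:A$ infer $\Gamma\vdash t\,u:B$; (sums) from $\Gamma\vdash t:A$ infer $\Gamma\vdash\mathrm{inl}\,t:A+B$; symmetrically for $\mathrm{inr}$; from $\Gamma\vdash s:A+B$, $\Gamma,x:A,\Gamma'\vdash t:C$, $\Gamma,y:B,\Gamma'\vdash u:C$ infer $\Gamma,\Gamma'\vdash\mathrm{case}\ s\ \mathrm{of}\ (x.t;\,y.u):C$ (any $\Gamma'$); from $\Gamma\vdash t:0$ infer $\Gamma,\Gamma'\vdash\mathrm{abort}\,t:A$ (any $\Gamma'$); (shut) from $\Gamma,\bullet\vdash t:A$ infer $\Gamma\vdash\mathrm{shut}\,t:\Box A$; (open) from $\Gamma\vdash t:\Box A$ infer $\Gamma,\bullet,\Gamma'\vdash\mathrm{open}\,t:A$ provided $\Gamma'$ contains no lock. Reduction: $\mapsto$ is the closure under all term formers of $(\lambda x.t)\,u\mapsto t[u/x]$; $\pi_i\langle t_1,t_2\rangle\mapsto t_i$; $\mathrm{case}\ (\mathrm{inl}\,s)\ \mathrm{of}\ (x.t;\,y.u)\mapsto t[s/x]$; $\mathrm{case}\ (\mathrm{inr}\,s)\ \mathrm{of}\ (x.t;\,y.u)\mapsto u[s/y]$; $\mathrm{open}\,\mathrm{shut}\,t\mapsto t$; and the commuting conversions $E[\mathrm{case}\ s\ \mathrm{of}\ (x.t;\,y.u)]\mapsto\mathrm{case}\ s\ \mathrm{of}\ (x.E[t];\,y.E[u])$ and $E[\mathrm{abort}\,t]\mapsto\mathrm{abort}\,t$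 for every elimination frame $E[-]$ among $[-]\,v$, $\pi_1[-]$, $\pi_2[-]$, $\mathrm{case}\ [-]\ \mathrm{of}\ (\ldots)$, $\mathrm{abort}[-]$, $\mathrm{open}[-]$. A term is normal if it admits no reduction step $\mapsto$. -}

module Defs where

open import Data.Nat using (ℕ; zero; suc; _⊔_; _≟_)
open import Data.List using (List; []; _∷_; _++_; filter; map; foldr)
open import Data.List.Relation.Unary.Unique.Propositional using (Unique)
open import Data.Product using (Σ; ∃; ∃₂; _,_)
open import Data.Sum using (_⊎_)
open import Data.Empty using (⊥)
open import Data.Unit using (⊤)
open import Relation.Nullary using (¬_; yes; no)
open import Relation.Nullary.Decidable using (¬?)
open import Relation.Binary.PropositionalEquality using (_≡_)

infixr 6 _⇒_
infixr 7 _+ₜ_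
infixr 8 _×ₜ_

data Ty : Set where
  atom  : ℕ → Ty
  𝟙     : Ty
  _×ₜ_  : Ty → Ty → Ty
  _⇒_   : Ty → Ty → Ty
  𝟘     : Ty
  _+ₜ_  : Ty → Ty → Ty
  □     : Ty → Ty

Var : Set
Var = ℕ

data Tm : Set where
  var   : Var → Tm
  unit  : Tm
  pair  : Tm → Tm → Tm
  π₁    : Tm → Tm
  π₂    : Tm → Tm
  lam   : Var → Tm → Tm
  app   : Tm → Tm → Tm
  inl   : Tm → Tm
  inr   : Tm → Tm
  case  : Tm → Var → Tm → Var → Tm → Tm   -- case s of (x.t ; y.u)
  abort : Tm → Tm
  shut  : Tm → Tm
  open′ : Tm → Tm

infixl 5 _,_∶_
data Ctx : Set where
  ·      : Ctx
  _,_∶_  : Ctx → Var → Ty → Ctx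
  _,•    : Ctx → Ctx

infixl 4 _⧺_
_⧺_ : Ctx → Ctx → Ctx
Γ ⧺ ·          = Γ
Γ ⧺ (Δ , x ∶ A) = (Γ ⧺ Δ) , x ∶ A
Γ ⧺ (Δ ,•)     = (Γ ⧺ Δ) ,•

dom : Ctx → List Var
dom ·           = []
dom (Γ , x ∶ A) = x ∷ dom Γ
dom (Γ ,•)      = dom Γ

Distinct : Ctx → Set
Distinct Γ = Unique (dom Γ)

LockFree : Ctx → Set
LockFree ·           = ⊤
LockFree (Γ , x ∶ A) = LockFree Γ
LockFree (Γ ,•)      = ⊥

LockOnly : Ctx → Set
LockOnly ·           = ⊤
LockOnly (Γ , x ∶ A) = ⊥
LockOnly (Γ ,•)      = LockOnly Γ

infix 3 _⊢_∶_
data _⊢_∶_ : Ctx → Tm → Ty → Set where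
  ⊢var   : ∀ {Γ Γ′ x A} → Distinct ((Γ , x ∶ A) ⧺ Γ′) → LockFree Γ′ →
           (Γ , x ∶ A) ⧺ Γ′ ⊢ var x ∶ A
  ⊢unit  : ∀ {Γ} → Distinct Γ → Γ ⊢ unit ∶ 𝟙
  ⊢pair  : ∀ {Γ t u A B} → Distinct Γ → Γ ⊢ t ∶ A → Γ ⊢ u ∶ B →
           Γ ⊢ pair t u ∶ A ×ₜ B
  ⊢π₁    : ∀ {Γ t A B} → Distinct Γ → Γ ⊢ t ∶ A ×ₜ B → Γ ⊢ π₁ t ∶ A
  ⊢π₂    : ∀ {Γ t A B} → Distinct Γ → Γ ⊢ t ∶ A ×ₜ B → Γ ⊢ π₂ t ∶ B
  ⊢lam   : ∀ {Γ x t A B} → Distinct Γ → Γ , x ∶ A ⊢ t ∶ B →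
           Γ ⊢ lam x t ∶ A ⇒ B
  ⊢app   : ∀ {Γ t u A B} → Distinct Γ → Γ ⊢ t ∶ A ⇒ B → Γ ⊢ u ∶ A →
           Γ ⊢ app t u ∶ B
  ⊢inl   : ∀ {Γ t A B} → Distinct Γ → Γ ⊢ t ∶ A → Γ ⊢ inl t ∶ A +ₜ B
  ⊢inr   : ∀ {Γ t A B} → Distinct Γ → Γ ⊢ t ∶ B → Γ ⊢ inr t ∶ A +ₜ B
  ⊢case  : ∀ {Γ Γ′ s x t y u A B C} → Distinct (Γ ⧺ Γ′) →
           Γ ⊢ s ∶ A +ₜ B →
           (Γ , x ∶ A) ⧺ Γ′ ⊢ t ∶ C →
           (Γ , y ∶ B) ⧺ Γ′ ⊢ u ∶ C →
           Γ ⧺ Γ′ ⊢ case s x t y u ∶ C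
  ⊢abort : ∀ {Γ Γ′ t A} → Distinct (Γ ⧺ Γ′) → Γ ⊢ t ∶ 𝟘 →
           Γ ⧺ Γ′ ⊢ abort t ∶ A
  ⊢shut  : ∀ {Γ t A} → Distinct Γ → Γ ,• ⊢ t ∶ A → Γ ⊢ shut t ∶ □ A
  ⊢open  : ∀ {Γ Γ′ t A} → Distinct ((Γ ,•) ⧺ Γ′) → LockFree Γ′ →
           Γ ⊢ t ∶ □ A → (Γ ,•) ⧺ Γ′ ⊢ open′ t ∶ A

-- Capture-avoiding substitution (Stoughton-style simultaneous substitution)

-- free variables (possibly with repetitions)
fv : Tm → List Var
fv (var x)          = x ∷ []
fv unit             = []
fv (pair t u)       = fv t ++ fv u
fv (π₁ t)           = fv t
fv (π₂ t)           = fv t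
fv (lam x t)        = filter (λ z → ¬? (z ≟ x)) (fv t)
fv (app t u)        = fv t ++ fv u
fv (inl t)          = fv t
fv (inr t)          = fv t
fv (case s x t y u) = fv s ++ filter (λ z → ¬? (z ≟ x)) (fv t)
                           ++ filter (λ z → ¬? (z ≟ y)) (fv u)
fv (abort t)        = fv t
fv (shut t)         = fv t
fv (open′ t)        = fv t

maxv : Tm → ℕ
maxv (var x)          = x
maxv unit             = 0
maxv (pair t u)       = maxv t ⊔ maxv u
maxv (π₁ t)           = maxv t
maxv (π₂ t)           = maxv t
maxv (lam x t)        = x ⊔ maxv t
maxv (app t u)        = maxv t ⊔ maxv u
maxv (inl t)          = maxv t
maxv (inr t)          = maxv t
maxv (case s x t y u) = maxv s ⊔ x ⊔ maxv t ⊔ y ⊔ maxv u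
maxv (abort t)        = maxv t
maxv (shut t)         = maxv t
maxv (open′ t)        = maxv t

Sub : Set
Sub = Var → Tm

_[_↦_] : Sub → Var → Tm → Sub
(σ [ x ↦ u ]) z with z ≟ x
... | yes _ = u
... | no  _ = σ z

freshFor : Sub → List Var → Var
freshFor σ ws = suc (foldr (λ w m → maxv (σ w) ⊔ m) 0 ws)

subst : Sub → Tm → Tm
subst σ (var x)          = σ x
subst σ unit             = unit
subst σ (pair t u)       = pair (subst σ t) (subst σ u)
subst σ (π₁ t)           = π₁ (subst σ t)
subst σ (π₂ t)           = π₂ (subst σ t)
subst σ (lam x t)        =
  let z = freshFor σ (fv (lam x t)) in lam z (subst (σ [ x ↦ var z ]) t)
subst σ (app t u)        = app (subst σ t) (subst σ u)
subst σ (inl t)          = inl (subst σ t)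
subst σ (inr t)          = inr (subst σ t)
subst σ (case s x t y u) =
  let x′ = freshFor σ (filter (λ w → ¬? (w ≟ x)) (fv t))
      y′ = freshFor σ (filter (λ w → ¬? (w ≟ y)) (fv u))
  in case (subst σ s) x′ (subst (σ [ x ↦ var x′ ]) t)
                      y′ (subst (σ [ y ↦ var y′ ]) u)
subst σ (abort t)        = abort (subst σ t)
subst σ (shut t)         = shut (subst σ t)
subst σ (open′ t)        = open′ (subst σ t)

_[_/_] : Tm → Tm → Var → Tm
t [ u / x ] = subst (var [ x ↦ u ]) t

data Frame : Set where
  appF   : Tm → Frame
  π₁F    : Frame
  π₂F    : Frame
  caseF  : Var → Tm → Var → Tm → Frame
  abortF : Frame
  openF  : Frame

plug : Frame → Tm → Tm
plug (appF v)        t = app t v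
plug π₁F             t = π₁ t
plug π₂F             t = π₂ t
plug (caseF x t y u) s = case s x t y u
plug abortF          t = abort t
plug openF           t = open′ t

infix 3 _↦_
data _↦_ : Tm → Tm → Set where
  β⇒      : ∀ {x t u} → app (lam x t) u ↦ t [ u / x ]
  β×₁     : ∀ {t u} → π₁ (pair t u) ↦ t
  β×₂     : ∀ {t u} → π₂ (pair t u) ↦ u
  β+₁     : ∀ {s x t y u} → case (inl s) x t y u ↦ t [ s / x ]
  β+₂     : ∀ {s x t y u} → case (inr s) x t y u ↦ u [ s / y ]
  β□      : ∀ {t} → open′ (shut t) ↦ t
  cc-case : ∀ {E s x t y u} →
            plug E (case s x t y u) ↦ case s x (plug E t) y (plug E u)
  cc-abort : ∀ {E t} → plug E (abort t) ↦ abort t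
  ξpair₁  : ∀ {t t′ u} → t ↦ t′ → pair t u ↦ pair t′ u
  ξpair₂  : ∀ {t u u′} → u ↦ u′ → pair t u ↦ pair t u′
  ξπ₁     : ∀ {t t′} → t ↦ t′ → π₁ t ↦ π₁ t′
  ξπ₂     : ∀ {t t′} → t ↦ t′ → π₂ t ↦ π₂ t′
  ξlam    : ∀ {x t t′} → t ↦ t′ → lam x t ↦ lam x t′
  ξapp₁   : ∀ {t t′ u} → t ↦ t′ → app t u ↦ app t′ u
  ξapp₂   : ∀ {t u u′} → u ↦ u′ → app t u ↦ app t u′
  ξinl    : ∀ {t t′} → t ↦ t′ → inl t ↦ inl t′
  ξinr    : ∀ {t t′} → t ↦ t′ → inr t ↦ inr t′
  ξcase₀  : ∀ {s s′ x t y u} → s ↦ s′ → case s x t y u ↦ case s′ x t y u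
  ξcase₁  : ∀ {s x t t′ y u} → t ↦ t′ → case s x t y u ↦ case s x t′ y u
  ξcase₂  : ∀ {s x t y u u′} → u ↦ u′ → case s x t y u ↦ case s x t y u′
  ξabort  : ∀ {t t′} → t ↦ t′ → abort t ↦ abort t′
  ξshut   : ∀ {t t′} → t ↦ t′ → shut t ↦ shut t′
  ξopen   : ∀ {t t′} → t ↦ t′ → open′ t ↦ open′ t′

Normal : Tm → Set
Normal t = ∀ u → ¬ (t ↦ u)

IsIntroFor : Ty → Tm → Set
IsIntroFor (atom p)  t = ⊥
IsIntroFor 𝟙         t = t ≡ unit
IsIntroFor (A ×ₜ B)  t = ∃₂ λ a b → t ≡ pair a b
IsIntroFor (A ⇒ B)   t = ∃₂ λ x b → t ≡ lam x b
IsIntroFor 𝟘         t = ⊥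
IsIntroFor (A +ₜ B)  t = (∃ λ a → t ≡ inl a) ⊎ (∃ λ b → t ≡ inr b)
IsIntroFor (□ A)     t = ∃ λ a → t ≡ shut a

module Submission where

open import Defs
open import Data.Product using (_,_)
open import Data.Sum using (inj₁; inj₂)
open import Data.Empty using (⊥-elim)
open import Relation.Binary.PropositionalEquality using (refl)

-- Variables are impossible since the context
-- holds no assignments; an elimination form has a normal principal argument
-- typed in a lock-only prefix, so by induction that argument is an introduction
-- form, and the elimination would then be a β-redex (or, for 𝟘, there is no
-- introduction form at all).

LockOnly-⧺ˡ : ∀ Γ Δ → LockOnly (Γ ⧺ Δ) → LockOnly Γ
LockOnly-⧺ˡ Γ ·           p = p
LockOnly-⧺ˡ Γ (Δ , x ∶ A) ()
LockOnly-⧺ˡ Γ (Δ ,•)      p = LockOnly-⧺ˡ Γ Δ p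

Normal-plug⁻¹ : ∀ E {t} → Normal (plug E t) → Normal t
Normal-plug⁻¹ (appF v)        n u r = n (app u v)        (ξapp₁ r)
Normal-plug⁻¹ π₁F             n u r = n (π₁ u)           (ξπ₁ r)
Normal-plug⁻¹ π₂F             n u r = n (π₂ u)           (ξπ₂ r)
Normal-plug⁻¹ (caseF x t y v) n u r = n (case u x t y v) (ξcase₀ r)
Normal-plug⁻¹ abortF          n u r = n (abort u)        (ξabort r)
Normal-plug⁻¹ openF           n u r = n (open′ u)        (ξopen r)

theorem4 : ∀ {Γ t A} → LockOnly Γ → Γ ⊢ t ∶ A → Normal t → IsIntroFor A t
theorem4 lo (⊢var {Γ = Γ} {Γ′ = Δ} {x = x} {A = A} _ _) n =
  ⊥-elim (LockOnly-⧺ˡ (Γ , x ∶ A) Δ lo)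
theorem4 lo (⊢unit _)      n = refl
theorem4 lo (⊢pair _ _ _)  n = _ , _ , refl
theorem4 lo (⊢lam _ _)     n = _ , _ , refl
theorem4 lo (⊢inl _ _)     n = inj₁ (_ , refl)
theorem4 lo (⊢inr _ _)     n = inj₂ (_ , refl)
theorem4 lo (⊢shut _ _)    n = _ , refl
theorem4 lo (⊢π₁ _ d) n with theorem4 lo d (Normal-plug⁻¹ π₁F n)
... | _ , _ , refl = ⊥-elim (n _ β×₁)
theorem4 lo (⊢π₂ _ d) n with theorem4 lo d (Normal-plug⁻¹ π₂F n)
... | _ , _ , refl = ⊥-elim (n _ β×₂)
theorem4 lo (⊢app _ d _) n with theorem4 lo d (Normal-plug⁻¹ (appF _) n)
... | _ , _ , refl = ⊥-elim (n _ β⇒)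
theorem4 lo (⊢case {Γ = Γ} {Γ′ = Δ} _ d _ _) n
  with theorem4 (LockOnly-⧺ˡ Γ Δ lo) d (Normal-plug⁻¹ (caseF _ _ _ _) n)
... | inj₁ (_ , refl) = ⊥-elim (n _ β+₁)
... | inj₂ (_ , refl) = ⊥-elim (n _ β+₂)
theorem4 lo (⊢abort {Γ = Γ} {Γ′ = Δ} _ d) n =
  ⊥-elim (theorem4 (LockOnly-⧺ˡ Γ Δ lo) d (Normal-plug⁻¹ abortF n))
theorem4 lo (⊢open {Γ = Γ} {Γ′ = Δ} _ _ d) n
  with theorem4 (LockOnly-⧺ˡ (Γ ,•) Δ lo) d (Normal-plug⁻¹ openF n)
... | _ , refl = ⊥-elim (n _ β□)
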